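{- Let $r \ge 2$, $m$, $f$ be integers with $m \ge r$ and $0 \le f \le \binom{m}{r}$. If for some $k \in \mathbb{N}$ we have $\binom{k}{r} + m < f < \binom{k+1}{r}$, then there is no $r$-graph on $m$ vertices with exactly $f$ edges which is the vertex disjoint union of a complete $r$-graph and an $r$-graph with at most $m$ edges.
   Context: An $r$-graph is an $r$-uniform hypergraph. A complete $r$-graph on $l$ vertices has all $r$-subsets of its $l$ vertices as edges ($l \ge 0$; it has no edges if $l<r$). -}

module Defs where

open import Data.Nat using (ℕ; _≤_)
open import Data.Fin.Subset using (Subset; _⊆_; ∁; ∣_∣)
open import Data.List using (List; length)
open import Data.List.Membership.Propositional using (_∈_)
open import Data.List.Relation.Unary.All using (All)
open import Data.List.Relation.Unary.Unique.Propositional using (Unique)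
open import Data.Product using (Σ; _×_)
open import Data.Sum using (_⊎_)
open import Function.Bundles using (_⇔_)
open import Relation.Binary.PropositionalEquality using (_≡_)

record RGraph (r m : ℕ) : Set where
  constructor mkRGraph
  field
    edges    : List (Subset m)
    uniform  : All (λ e → ∣ e ∣ ≡ r) edges
    distinct : Unique edges
open RGraph public

numEdges : ∀ {r m} → RGraph r m → ℕ
numEdges G = length (edges G)

IsCompletePlusSmall : ∀ {r m} → RGraph r m → Set
IsCompletePlusSmall {r} {m} G =
  Σ (Subset m) λ A →
  Σ (RGraph r m) λ H →
    (numEdges H ≤ m) ×
    (All (λ e → e ⊆ ∁ A) (edges H)) ×
    (∀ (e : Subset m) →
       (e ∈ edges G) ⇔ (((e ⊆ A) × (∣ e ∣ ≡ r)) ⊎ (e ∈ edges H)))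

-- Write a for the size of the clique A.  The edges of G are the r-subsets of
-- A together with the edges of H, so a C r ≤ f ≤ a C r + m.  Since a ↦ a C r
-- is monotone, either a ≤ k and then f ≤ k C r + m, or a ≥ k + 1 and then
-- f ≥ (k + 1) C r; both contradict the hypotheses on f.
{-# OPTIONS --safe #-}
module Submission where

open import Defs
open import Data.Empty using (⊥-elim)
open import Data.Fin.Subset using (Subset; inside; outside; _⊆_; ∣_∣)
open import Data.Fin.Subset.Properties using (⊆-refl; drop-∷-⊆; out⊆; in⊆in)
open import Data.List using (List; []; _∷_; [_]; _++_; map; length)
open import Data.List.Properties using (length-++; length-map; length-removeAt′)
open import Data.List.Membership.Propositional using (_∈_; _─_)
open import Data.List.Membership.Propositional.Properties
  using (∈-map⁺; ∈-map⁻; ∈-++⁺ˡ; ∈-++⁺ʳ; ∈-++⁻)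
open import Data.List.Relation.Binary.Subset.Propositional as List using ()
open import Data.List.Relation.Unary.All as All using ()
open import Data.List.Relation.Unary.AllPairs using ([]; _∷_)
open import Data.List.Relation.Unary.Any using (here; there)
open import Data.List.Relation.Unary.Unique.Propositional using (Unique)
import Data.List.Relation.Unary.Unique.Propositional.Properties as Unique
open import Data.Nat using (ℕ; zero; suc; _+_; _≤_; _<_; _≤′_; ≤′-refl; ≤′-step; z≤n; s≤s)
open import Data.Nat.Combinatorics using (_C_; nCk+nC[k+1]≡[n+1]C[k+1])
open import Data.Nat.Properties
open import Data.Product using (Σ; _×_; _,_)
open import Data.Sum using (_⊎_; inj₁; inj₂)
open import Data.Vec.Base as Vec using ([]; _∷_)
open import Data.Vec.Properties using (∷-injectiveʳ)
open import Function.Bundles using (_⇔_; Equivalence)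
open import Relation.Binary.PropositionalEquality using (_≡_; _≢_; refl; cong; cong₂; trans; module ≡-Reasoning)
open import Relation.Nullary using (¬_; yes; no)

module _ {A : Set} where

  ∈-─⁺ : ∀ {x y : A} {ys : List A} → y ∈ ys → (x∈ys : x ∈ ys) → x ≢ y → y ∈ ys ─ x∈ys
  ∈-─⁺ (here refl) (here refl) x≢y = ⊥-elim (x≢y refl)
  ∈-─⁺ (here y≡z)  (there _)   _   = here y≡z
  ∈-─⁺ (there y∈)  (here refl) _   = y∈
  ∈-─⁺ (there y∈)  (there x∈)  x≢y = there (∈-─⁺ y∈ x∈ x≢y)

  Unique-⊆⇒length-≤ : ∀ {xs ys : List A} → Unique xs → xs List.⊆ ys → length xs ≤ length ys
  Unique-⊆⇒length-≤ {[]}     []               _     = z≤n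
  Unique-⊆⇒length-≤ {x ∷ xs} {ys} (x∉xs ∷ xs!) xs⊆ys = begin
      suc (length xs)               ≤⟨ s≤s (Unique-⊆⇒length-≤ xs! xs⊆ys─x) ⟩
      suc (length (ys ─ x∈ys))      ≡⟨ length-removeAt′ ys _ ⟨
      length ys                     ∎
    where
    open ≤-Reasoning
    x∈ys : x ∈ ys
    x∈ys = xs⊆ys (here refl)
    xs⊆ys─x : xs List.⊆ ys ─ x∈ys
    xs⊆ys─x y∈xs = ∈-─⁺ (xs⊆ys (there y∈xs)) x∈ys (All.lookup x∉xs y∈xs)

subsets : ∀ {n} → Subset n → ℕ → List (Subset n)
subsets []            zero    = [ [] ]
subsets []            (suc r) = []
subsets (outside ∷ A) r       = map (outside ∷_) (subsets A r)
subsets (inside ∷ A)  zero    = map (outside ∷_) (subsets A zero)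
subsets (inside ∷ A)  (suc r) = map (outside ∷_) (subsets A (suc r)) ++ map (inside ∷_) (subsets A r)

length-subsets : ∀ {n} (A : Subset n) r → length (subsets A r) ≡ ∣ A ∣ C r
length-subsets []            zero    = refl
length-subsets []            (suc r) = refl
length-subsets (outside ∷ A) r       = trans (length-map _ (subsets A r)) (length-subsets A r)
length-subsets (inside ∷ A)  zero    = trans (length-map _ (subsets A zero)) (length-subsets A zero)
length-subsets (inside ∷ A)  (suc r) = begin
    length (map (outside ∷_) (subsets A (suc r)) ++ map (inside ∷_) (subsets A r))
  ≡⟨ length-++ (map (outside ∷_) (subsets A (suc r))) ⟩
    length (map (outside ∷_) (subsets A (suc r))) + length (map (inside ∷_) (subsets A r))
  ≡⟨ cong₂ _+_ (trans (length-map _ (subsets A (suc r))) (length-subsets A (suc r)))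
               (trans (length-map _ (subsets A r)) (length-subsets A r)) ⟩
    ∣ A ∣ C suc r + ∣ A ∣ C r
  ≡⟨ +-comm (∣ A ∣ C suc r) _ ⟩
    ∣ A ∣ C r + ∣ A ∣ C suc r
  ≡⟨ nCk+nC[k+1]≡[n+1]C[k+1] ∣ A ∣ r ⟩
    suc ∣ A ∣ C suc r
  ∎
  where open ≡-Reasoning

∈-subsets⁻ : ∀ {n} (A : Subset n) r {e} → e ∈ subsets A r → e ⊆ A × ∣ e ∣ ≡ r
∈-subsets⁻ []            zero    (here refl) = ⊆-refl , refl
∈-subsets⁻ (outside ∷ A) r       e∈ with ∈-map⁻ _ e∈
... | _ , e′∈ , refl = let e′⊆A , ∣e′∣ = ∈-subsets⁻ A r e′∈ in out⊆ e′⊆A , ∣e′∣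
∈-subsets⁻ (inside ∷ A)  zero    e∈ with ∈-map⁻ _ e∈
... | _ , e′∈ , refl = let e′⊆A , ∣e′∣ = ∈-subsets⁻ A zero e′∈ in out⊆ e′⊆A , ∣e′∣
∈-subsets⁻ (inside ∷ A)  (suc r) e∈ with ∈-++⁻ (map (outside ∷_) (subsets A (suc r))) e∈
... | inj₁ e∈out with ∈-map⁻ _ e∈out
...   | _ , e′∈ , refl = let e′⊆A , ∣e′∣ = ∈-subsets⁻ A (suc r) e′∈ in out⊆ e′⊆A , ∣e′∣
∈-subsets⁻ (inside ∷ A)  (suc r) e∈ | inj₂ e∈in with ∈-map⁻ _ e∈in
...   | _ , e′∈ , refl = let e′⊆A , ∣e′∣ = ∈-subsets⁻ A r e′∈ in in⊆in e′⊆A , cong suc ∣e′∣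

∈-subsets⁺ : ∀ {n} (A : Subset n) r {e} → e ⊆ A → ∣ e ∣ ≡ r → e ∈ subsets A r
∈-subsets⁺ []            zero    {[]}          _   refl = here refl
∈-subsets⁺ (outside ∷ A) r       {outside ∷ e} e⊆A ∣e∣ =
  ∈-map⁺ _ (∈-subsets⁺ A r (drop-∷-⊆ e⊆A) ∣e∣)
∈-subsets⁺ (outside ∷ A) r       {inside ∷ e}  e⊆A ∣e∣ with e⊆A Vec.here
... | ()
∈-subsets⁺ (inside ∷ A)  zero    {outside ∷ e} e⊆A ∣e∣ =
  ∈-map⁺ _ (∈-subsets⁺ A zero (drop-∷-⊆ e⊆A) ∣e∣)
∈-subsets⁺ (inside ∷ A)  (suc r) {outside ∷ e} e⊆A ∣e∣ =
  ∈-++⁺ˡ (∈-map⁺ _ (∈-subsets⁺ A (suc r) (drop-∷-⊆ e⊆A) ∣e∣))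
∈-subsets⁺ (inside ∷ A)  (suc r) {inside ∷ e}  e⊆A ∣e∣ =
  ∈-++⁺ʳ (map (outside ∷_) (subsets A (suc r)))
         (∈-map⁺ _ (∈-subsets⁺ A r (drop-∷-⊆ e⊆A) (suc-injective ∣e∣)))

subsets-unique : ∀ {n} (A : Subset n) r → Unique (subsets A r)
subsets-unique []            zero    = All.[] ∷ []
subsets-unique []            (suc r) = []
subsets-unique (outside ∷ A) r       = Unique.map⁺ ∷-injectiveʳ (subsets-unique A r)
subsets-unique (inside ∷ A)  zero    = Unique.map⁺ ∷-injectiveʳ (subsets-unique A zero)
subsets-unique (inside ∷ A)  (suc r) =
  Unique.++⁺ (Unique.map⁺ ∷-injectiveʳ (subsets-unique A (suc r)))
             (Unique.map⁺ ∷-injectiveʳ (subsets-unique A r))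
             disjoint
  where
  disjoint : ∀ {e} → ¬ (e ∈ map (outside ∷_) (subsets A (suc r)) × e ∈ map (inside ∷_) (subsets A r))
  disjoint (e∈out , e∈in) with ∈-map⁻ _ e∈out | ∈-map⁻ _ e∈in
  ... | _ , _ , refl | _ , _ , ()

nCk≤[1+n]Ck : ∀ n k → n C k ≤ suc n C k
nCk≤[1+n]Ck n zero    = ≤-refl
nCk≤[1+n]Ck n (suc k) = begin
  n C suc k                  ≤⟨ m≤n+m _ (n C k) ⟩
  n C k + n C suc k          ≡⟨ nCk+nC[k+1]≡[n+1]C[k+1] n k ⟩
  suc n C suc k              ∎
  where open ≤-Reasoning

C-monoˡ-≤ : ∀ k {m n} → m ≤ n → m C k ≤ n C k
C-monoˡ-≤ k m≤n = go (≤⇒≤′ m≤n)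
  where
  go : ∀ {m n} → m ≤′ n → m C k ≤ n C k
  go ≤′-refl       = ≤-refl
  go (≤′-step m≤n) = ≤-trans (go m≤n) (nCk≤[1+n]Ck _ k)

module _ {r m : ℕ} (G : RGraph r m) (A : Subset m) (H : RGraph r m)
         (edges-G : ∀ e → (e ∈ edges G) ⇔ ((e ⊆ A × ∣ e ∣ ≡ r) ⊎ e ∈ edges H)) where

  clique-C≤numEdges : ∣ A ∣ C r ≤ numEdges G
  clique-C≤numEdges = begin
    ∣ A ∣ C r              ≡⟨ length-subsets A r ⟨
    length (subsets A r)   ≤⟨ Unique-⊆⇒length-≤ (subsets-unique A r) subsets⊆G ⟩
    numEdges G             ∎
    where
    open ≤-Reasoning
    subsets⊆G : subsets A r List.⊆ edges G
    subsets⊆G {e} e∈ = Equivalence.from (edges-G e) (inj₁ (∈-subsets⁻ A r e∈))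

  numEdges≤clique-C+numEdges : numEdges G ≤ ∣ A ∣ C r + numEdges H
  numEdges≤clique-C+numEdges = begin
    numEdges G                              ≤⟨ Unique-⊆⇒length-≤ (distinct G) G⊆subsets++H ⟩
    length (subsets A r ++ edges H)         ≡⟨ length-++ (subsets A r) ⟩
    length (subsets A r) + numEdges H       ≡⟨ cong (_+ numEdges H) (length-subsets A r) ⟩
    ∣ A ∣ C r + numEdges H                  ∎
    where
    open ≤-Reasoning
    G⊆subsets++H : edges G List.⊆ subsets A r ++ edges H
    G⊆subsets++H {e} e∈ with Equivalence.to (edges-G e) e∈
    ... | inj₁ (e⊆A , ∣e∣) = ∈-++⁺ˡ (∈-subsets⁺ A r e⊆A ∣e∣)
    ... | inj₂ e∈H         = ∈-++⁺ʳ (subsets A r) e∈H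

C+m<-in-binomial-gap : ∀ r m k f → k C r + m < f → f < suc k C r →
                           ∀ a → a C r ≤ f → a C r + m < f
C+m<-in-binomial-gap r m k f k-below f-below a aCr≤f with a ≤? k
... | yes a≤k = ≤-<-trans (+-monoˡ-≤ m (C-monoˡ-≤ r a≤k)) k-below
... | no  a≰k = ⊥-elim (<⇒≱ f-below (≤-trans (C-monoˡ-≤ r (≰⇒> a≰k)) aCr≤f))

lemma2p5 : (r m f : ℕ) → 2 ≤ r → r ≤ m → f ≤ m C r →
    (k : ℕ) → (k C r) + m < f → f < (suc k) C r →
    ¬ (Σ (RGraph r m) λ G → (numEdges G ≡ f) × IsCompletePlusSmall G)
lemma2p5 r m f _ _ _ k k-below f-below (G , refl , A , H , H≤m , _ , edges-G) =
  <⇒≱ (C+m<-in-binomial-gap r m k f k-below f-below ∣ A ∣ lower) upper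
  where
  lower : ∣ A ∣ C r ≤ numEdges G
  lower = clique-C≤numEdges G A H edges-G
  upper : numEdges G ≤ ∣ A ∣ C r + m
  upper = ≤-trans (numEdges≤clique-C+numEdges G A H edges-G) (+-monoʳ-≤ (∣ A ∣ C r) H≤m)
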